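{- For every integer $n\geq 3$, $\chi_{lid}(C_3\square C_n)=5$.
   Context: $C_n$ denotes the cycle on $n$ vertices. A proper $k$-coloring of a graph $G$ is a map $f:V(G)\to\{1,\dots,k\}$ with $f(u)\neq f(v)$ for every edge $uv$. For a vertex $v$, $N[v]$ denotes its closed neighborhood, and $f(S)=\{f(x):x\in S\}$. A lid-coloring of $G$ is a proper coloring $f$ such that for every edge $uv$ with $N[u]\neq N[v]$ we have $f(N[u])\neq f(N[v])$; $\chi_{lid}(G)$ is the smallest number of colors in a lid-coloring of $G$. The Cartesian product $G\square H$ has vertex set $V(G)\times V(H)$, where $(u_1,v_1)$ and $(u_2,v_2)$ are adjacent iff either $u_1=u_2$ and $v_1v_2\in E(H)$, or $v_1=v_2$ and $u_1u_2\in E(G)$. -}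

module Defs where

open import Data.Nat using (ℕ; zero; suc; _<_)
open import Data.Fin using (Fin; toℕ)
open import Data.Product using (Σ; _×_; _,_)
open import Data.Sum using (_⊎_)
open import Relation.Nullary using (¬_)
open import Relation.Binary.PropositionalEquality using (_≡_)
open import Function.Bundles using (_⇔_)

record Graph : Set₁ where
  field
    V   : Set
    Adj : V → V → Set
open Graph public

-- Cycle C_n on vertex set Fin n = {0,…,n-1}: i ~ j iff j = i+1 or i = j+1
-- or {i,j} = {0,n-1}.  (This is the cycle C_n whenever n ≥ 3.)
CycAdj : (n : ℕ) → ℕ → ℕ → Set
CycAdj n i j = (suc i ≡ j) ⊎ (suc j ≡ i)
             ⊎ ((i ≡ 0) × (suc j ≡ n)) ⊎ ((j ≡ 0) × (suc i ≡ n))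

Cycle : ℕ → Graph
Cycle n = record { V = Fin n ; Adj = λ i j → CycAdj n (toℕ i) (toℕ j) }

_□_ : Graph → Graph → Graph
G □ H = record
  { V   = V G × V H
  ; Adj = λ { (u₁ , v₁) (u₂ , v₂) →
              ((u₁ ≡ u₂) × Adj H v₁ v₂) ⊎ ((v₁ ≡ v₂) × Adj G u₁ u₂) } }

N[_] : {G : Graph} → V G → V G → Set
N[_] {G} v x = (x ≡ v) ⊎ Adj G v x

_≐_ : {A : Set} → (A → Set) → (A → Set) → Set
P ≐ Q = ∀ a → (P a ⇔ Q a)

image : {A B : Set} → (A → B) → (A → Set) → B → Set
image f S b = Σ _ λ x → S x × (f x ≡ b)

IsProper : (G : Graph) {k : ℕ} → (V G → Fin k) → Set
IsProper G f = ∀ u v → Adj G u v → ¬ (f u ≡ f v)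

IsLidColoring : (G : Graph) {k : ℕ} → (V G → Fin k) → Set
IsLidColoring G f =
  IsProper G f ×
  (∀ u v → Adj G u v → ¬ (N[_] {G} u ≐ N[_] {G} v) →
     ¬ (image f (N[_] {G} u) ≐ image f (N[_] {G} v)))

LidChromaticNumber : Graph → ℕ → Set
LidChromaticNumber G k =
  Σ (V G → Fin k) (IsLidColoring G) ×
  (∀ j → j < k → (f : V G → Fin j) → ¬ IsLidColoring G f)

-- Five colours: give every column of C₃ □ Cₙ a letter X ∈ {0,1,2} and colour its three
-- vertices by the triple paint X.  The colour set of N[(a , b)] then depends only on the
-- letters of columns b-1, b, b+1 and on a, and a finite check shows that adjacent vertices
-- get different colour sets as long as consecutive letters are related by Step.  Since Step
-- contains the cycles 0 1 0 and 0 1 2 0, it has closed walks of every length n ≥ 2.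
--
-- At most four colours: the three vertices of a column b get distinct colours t₀ t₁ t₂ and
-- at most one other colour exists, so the colour set of N[(a , b)] is {t₀,t₁,t₂} or
-- everything according to whether both horizontal neighbours of (a , b) are coloured
-- inside {t₀,t₁,t₂}.  Two of the three rows agree on this, which gives two adjacent vertices
-- with different closed neighbourhoods but equal colour sets.

module Submission where

open import Defs
open import Data.Bool using (Bool; true; false; T)
open import Data.Bool.Properties using (T?)
open import Data.Empty using (⊥-elim)
open import Data.Fin using (Fin; zero; suc; toℕ; fromℕ; inject₁; _≟_)
open import Data.Fin.Properties using (all?; toℕ-injective; toℕ<n; toℕ-fromℕ; toℕ-inject₁; toℕ-inject₁-≢)
open import Data.Fin.Relation.Unary.Top using (view; ‵fromℕ; ‵inject₁; view-fromℕ; view-inject₁)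
open import Data.List using (List; []; _∷_; _++_; map)
open import Data.List.Membership.Propositional using (_∈_; _∉_; find)
open import Data.List.Membership.Propositional.Properties using (∈-map⁺; ∈-map⁻; ∈-++⁺ˡ; ∈-++⁺ʳ; ∈-++⁻)
import Data.List.Membership.DecPropositional as DecMembership
open import Data.List.Relation.Binary.Subset.Propositional using (_⊆_)
open import Data.List.Relation.Unary.All as All using (All)
open import Data.List.Relation.Unary.All.Properties using (¬All⇒Any¬)
open import Data.List.Relation.Unary.Any using (here; there)
open import Data.Nat using (ℕ; zero; suc; _≤_; _<_; s≤s)
open import Data.Nat.Properties using (1+n≢n; <-irrefl; suc-injective)
open import Data.Product using (_×_; _,_; proj₁; ∃₂)
open import Data.Sum using (_⊎_; inj₁; inj₂)
open import Data.Unit using (tt)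
open import Function using (_∘_)
open import Function.Bundles using (_⇔_; mk⇔; Equivalence)
import Function.Properties.Equivalence as ⇔
open import Relation.Binary.Definitions using (DecidableEquality)
open import Relation.Nullary using (¬_; Dec; yes; no)
open import Relation.Nullary.Decidable using (map′; _×-dec_; _→-dec_; ¬?; toWitness)
open import Relation.Binary.PropositionalEquality using (_≡_; _≢_; refl; sym; trans; cong; subst)

open Equivalence using (to; from)

pattern 0F = zero
pattern 1F = suc zero
pattern 2F = suc (suc zero)
pattern 3F = suc (suc (suc zero))
pattern 4F = suc (suc (suc (suc zero)))

≐-sym : {A : Set} {P Q : A → Set} → P ≐ Q → Q ≐ P
≐-sym P≐Q a = ⇔.sym (P≐Q a)

≐-trans : {A : Set} {P Q R : A → Set} → P ≐ Q → Q ≐ R → P ≐ R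
≐-trans P≐Q Q≐R a = ⇔.trans (P≐Q a) (Q≐R a)

_⇔-dec_ : {P Q : Set} → Dec P → Dec Q → Dec (P ⇔ Q)
p? ⇔-dec q? = map′ (λ (pq , qp) → mk⇔ pq qp) (λ e → to e , from e) ((p? →-dec q?) ×-dec (q? →-dec p?))

_≐∈_ : {A : Set} → List A → List A → Set
xs ≐∈ ys = (_∈ xs) ≐ (_∈ ys)

image-≐-map : {A B : Set} (f : A → B) {S : A → Set} {xs : List A} →
              S ≐ (_∈ xs) → image f S ≐ (_∈ map f xs)
image-≐-map f {xs = xs} S≐xs b = mk⇔
  (λ (x , Sx , fx≡b) → subst (_∈ map f xs) fx≡b (∈-map⁺ f (to (S≐xs x) Sx)))
  (λ b∈ → let x , x∈xs , b≡fx = ∈-map⁻ f b∈ in x , from (S≐xs x) x∈xs , sym b≡fx)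

≐∈? : ∀ {j} (xs ys : List (Fin j)) → Dec (xs ≐∈ ys)
≐∈? xs ys = all? λ c → (c ∈? xs) ⇔-dec (c ∈? ys)
  where open DecMembership _≟_

CycAdj-irrefl : ∀ {n} i → ¬ CycAdj (suc (suc n)) i i
CycAdj-irrefl i (inj₁ e)                         = 1+n≢n e
CycAdj-irrefl i (inj₂ (inj₁ e))                  = 1+n≢n e
CycAdj-irrefl i (inj₂ (inj₂ (inj₁ (refl , ()))))
CycAdj-irrefl i (inj₂ (inj₂ (inj₂ (refl , ()))))

CycSucc : ℕ → ℕ → ℕ → Set
CycSucc n i j = (suc i ≡ j) ⊎ ((j ≡ 0) × (suc i ≡ n))

CycAdj⇒CycSucc : ∀ {n i j} → CycAdj n i j → CycSucc n i j ⊎ CycSucc n j i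
CycAdj⇒CycSucc (inj₁ e)                = inj₁ (inj₁ e)
CycAdj⇒CycSucc (inj₂ (inj₁ e))         = inj₂ (inj₁ e)
CycAdj⇒CycSucc (inj₂ (inj₂ (inj₁ e)))  = inj₂ (inj₂ e)
CycAdj⇒CycSucc (inj₂ (inj₂ (inj₂ e)))  = inj₁ (inj₂ e)

CycSucc⇒CycAdj : ∀ {n i j} → CycSucc n i j → CycAdj n i j
CycSucc⇒CycAdj (inj₁ e) = inj₁ e
CycSucc⇒CycAdj (inj₂ e) = inj₂ (inj₂ (inj₂ e))

CycSucc⇒CycAdj˘ : ∀ {n i j} → CycSucc n j i → CycAdj n i j
CycSucc⇒CycAdj˘ (inj₁ e) = inj₂ (inj₁ e)
CycSucc⇒CycAdj˘ (inj₂ e) = inj₂ (inj₂ (inj₁ e))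

next : ∀ {k} → Fin (suc k) → Fin (suc k)
next i with view i
... | ‵fromℕ     = zero
... | ‵inject₁ j = suc j

prev : ∀ {k} → Fin (suc k) → Fin (suc k)
prev {k} zero = fromℕ k
prev (suc j)  = inject₁ j

prev-next : ∀ {k} (b : Fin (suc k)) → prev (next b) ≡ b
prev-next b with view b
... | ‵fromℕ     = refl
... | ‵inject₁ j = refl

next-prev : ∀ {k} (b : Fin (suc k)) → next (prev b) ≡ b
next-prev {k} zero rewrite view-fromℕ k  = refl
next-prev (suc j)  rewrite view-inject₁ j = refl

CycSucc-next : ∀ {k} (b : Fin (suc k)) → CycSucc (suc k) (toℕ b) (toℕ (next b))
CycSucc-next {k} b with view b
... | ‵fromℕ     = inj₂ (refl , cong suc (toℕ-fromℕ k))
... | ‵inject₁ j = inj₁ (cong suc (toℕ-inject₁ j))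

CycSucc⇒next : ∀ {k} (b c : Fin (suc k)) → CycSucc (suc k) (toℕ b) (toℕ c) → c ≡ next b
CycSucc⇒next {k} b c succ with view b | succ
... | ‵fromℕ     | inj₁ e       =
  ⊥-elim (<-irrefl refl (subst (_< suc k) (trans (sym e) (cong suc (toℕ-fromℕ k))) (toℕ<n c)))
... | ‵fromℕ     | inj₂ (e , _) = toℕ-injective e
... | ‵inject₁ j | inj₁ e       = toℕ-injective (trans (sym e) (cong suc (toℕ-inject₁ j)))
... | ‵inject₁ j | inj₂ (_ , e) = ⊥-elim (toℕ-inject₁-≢ j (sym (suc-injective e)))

adj-next : ∀ {k} (b : Fin (suc k)) → CycAdj (suc k) (toℕ b) (toℕ (next b))
adj-next b = CycSucc⇒CycAdj (CycSucc-next b)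

adj-prev : ∀ {k} (b : Fin (suc k)) → CycAdj (suc k) (toℕ b) (toℕ (prev b))
adj-prev {k} b =
  CycSucc⇒CycAdj˘ (subst (λ c → CycSucc (suc k) (toℕ (prev b)) (toℕ c)) (next-prev b) (CycSucc-next (prev b)))

adj⇒prev⊎next : ∀ {k} (b c : Fin (suc k)) → CycAdj (suc k) (toℕ b) (toℕ c) → c ≡ prev b ⊎ c ≡ next b
adj⇒prev⊎next b c adj with CycAdj⇒CycSucc adj
... | inj₁ b→c = inj₂ (CycSucc⇒next b c b→c)
... | inj₂ c→b = inj₁ (trans (sym (prev-next c)) (cong prev (sym (CycSucc⇒next c b c→b))))

next-≢ : ∀ {m} (b : Fin (suc (suc m))) → next b ≢ b
next-≢ b e = CycAdj-irrefl (toℕ b) (subst (λ c → CycAdj _ (toℕ b) (toℕ c)) e (adj-next b))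

ClosedWalk : ∀ {k} {A : Set} → (A → A → Set) → (Fin (suc k) → A) → Set
ClosedWalk R w = ∀ b → R (w b) (w (next b))

closedWalk-intro : ∀ {k} {A : Set} {R : A → A → Set} (w : Fin (suc k) → A) →
                   (∀ j → R (w (inject₁ j)) (w (suc j))) → R (w (fromℕ k)) (w zero) →
                   ClosedWalk R w
closedWalk-intro w consecutive wrap b with view b
... | ‵fromℕ     = wrap
... | ‵inject₁ j = consecutive j

closedWalk-into : ∀ {k} {A : Set} {R : A → A → Set} {w : Fin (suc k) → A} →
                  ClosedWalk R w → ∀ b → R (w (prev b)) (w b)
closedWalk-into {R = R} {w} walk b = subst (λ c → R (w (prev b)) (w c)) (next-prev b) (walk (prev b))

C₃-adj : (a a' : Fin 3) → a ≢ a' → CycAdj 3 (toℕ a) (toℕ a')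
C₃-adj 0F 0F a≢a' = ⊥-elim (a≢a' refl)
C₃-adj 0F 1F _    = inj₁ refl
C₃-adj 0F 2F _    = inj₂ (inj₂ (inj₁ (refl , refl)))
C₃-adj 1F 0F _    = inj₂ (inj₁ refl)
C₃-adj 1F 1F a≢a' = ⊥-elim (a≢a' refl)
C₃-adj 1F 2F _    = inj₁ refl
C₃-adj 2F 0F _    = inj₂ (inj₂ (inj₂ (refl , refl)))
C₃-adj 2F 1F _    = inj₂ (inj₁ refl)
C₃-adj 2F 2F a≢a' = ⊥-elim (a≢a' refl)

C₃-adj⇒≢ : {a a' : Fin 3} → CycAdj 3 (toℕ a) (toℕ a') → a ≢ a'
C₃-adj⇒≢ {a} adj refl = CycAdj-irrefl (toℕ a) adj

Prism : ℕ → Graph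
Prism n = Cycle 3 □ Cycle n

column : ∀ {k} → Fin (suc k) → List (V (Prism (suc k)))
column b = (0F , b) ∷ (1F , b) ∷ (2F , b) ∷ []

closedNbhd : ∀ {k} → V (Prism (suc k)) → List (V (Prism (suc k)))
closedNbhd (a , b) = column b ++ (a , prev b) ∷ (a , next b) ∷ []

∈-column : ∀ {k} a (b : Fin (suc k)) → (a , b) ∈ column b
∈-column 0F b = here refl
∈-column 1F b = there (here refl)
∈-column 2F b = there (there (here refl))

N-column : ∀ {k} a a' (b : Fin (suc k)) → N[_] {Prism (suc k)} (a , b) (a' , b)
N-column a a' b with a' ≟ a
... | yes refl = inj₁ refl
... | no a'≢a  = inj₂ (inj₂ (refl , C₃-adj a a' (a'≢a ∘ sym)))

N≐closedNbhd : ∀ {k} (u : V (Prism (suc k))) → N[_] {Prism (suc k)} u ≐ (_∈ closedNbhd u)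
N≐closedNbhd (a , b) y = mk⇔ (N⇒∈ y) (∈⇒N y)
  where
  N⇒∈ : ∀ y → N[_] {Prism _} (a , b) y → y ∈ closedNbhd (a , b)
  N⇒∈ _        (inj₁ refl)                 = ∈-++⁺ˡ (∈-column a b)
  N⇒∈ (_ , b') (inj₂ (inj₁ (refl , adj))) with adj⇒prev⊎next b b' adj
  ... | inj₁ refl = ∈-++⁺ʳ (column b) (here refl)
  ... | inj₂ refl = ∈-++⁺ʳ (column b) (there (here refl))
  N⇒∈ (a' , _) (inj₂ (inj₂ (refl , _)))    = ∈-++⁺ˡ (∈-column a' b)

  ∈⇒N : ∀ y → y ∈ closedNbhd (a , b) → N[_] {Prism _} (a , b) y
  ∈⇒N y y∈ with ∈-++⁻ (column b) y∈
  ... | inj₁ (here refl)                 = N-column a 0F b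
  ... | inj₁ (there (here refl))         = N-column a 1F b
  ... | inj₁ (there (there (here refl))) = N-column a 2F b
  ... | inj₂ (here refl)                 = inj₂ (inj₁ (refl , adj-prev b))
  ... | inj₂ (there (here refl))         = inj₂ (inj₁ (refl , adj-next b))

closedNbhds-differ : ∀ {m} {a a' : Fin 3} (b : Fin (suc (suc m))) → a ≢ a' →
                     ¬ (N[_] {Prism (suc (suc m))} (a , b) ≐ N[_] {Prism (suc (suc m))} (a' , b))
closedNbhds-differ b a≢a' N≐ with to (N≐ (_ , next b)) (inj₂ (inj₁ (refl , adj-next b)))
... | inj₁ e                = a≢a' (cong proj₁ e)
... | inj₂ (inj₁ (e , _))   = a≢a' (sym e)
... | inj₂ (inj₂ (e , _))   = next-≢ b (sym e)

nbhdColors : ∀ {k j} → (V (Prism (suc k)) → Fin j) → V (Prism (suc k)) → List (Fin j)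
nbhdColors f u = map f (closedNbhd u)

nbhdImages≐ : ∀ {k j} (f : V (Prism (suc k)) → Fin j) u v →
              nbhdColors f u ≐∈ nbhdColors f v →
              image f (N[_] {Prism (suc k)} u) ≐ image f (N[_] {Prism (suc k)} v)
nbhdImages≐ f u v colors≐ =
  ≐-trans (image-≐-map f (N≐closedNbhd u)) (≐-trans colors≐ (≐-sym (image-≐-map f (N≐closedNbhd v))))

nbhdColors≐ : ∀ {k j} (f : V (Prism (suc k)) → Fin j) u v →
               image f (N[_] {Prism (suc k)} u) ≐ image f (N[_] {Prism (suc k)} v) →
               nbhdColors f u ≐∈ nbhdColors f v
nbhdColors≐ f u v images≐ =
  ≐-trans (≐-sym (image-≐-map f (N≐closedNbhd u))) (≐-trans images≐ (image-≐-map f (N≐closedNbhd v)))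

-- Five colors suffice

step : Fin 3 → Fin 3 → Bool
step 0F 1F = true
step 1F 0F = true
step 1F 2F = true
step 2F 0F = true
step _  _  = false

Step : Fin 3 → Fin 3 → Set
Step X Y = T (step X Y)

paint : Fin 3 → Fin 3 → Fin 5
paint 0F 0F = 0F
paint 0F 1F = 1F
paint 0F 2F = 2F
paint 1F 0F = 1F
paint 1F 1F = 3F
paint 1F 2F = 4F
paint 2F 0F = 2F
paint 2F 1F = 4F
paint 2F 2F = 1F

-- The colours of N[(a , b)] when columns b-1, b, b+1 carry the letters W, X, Y.
letterColors : (W X Y : Fin 3) → Fin 3 → List (Fin 5)
letterColors W X Y a = paint X 0F ∷ paint X 1F ∷ paint X 2F ∷ paint W a ∷ paint Y a ∷ []

paint-properʰ : ∀ X Y a → Step X Y → paint X a ≢ paint Y a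
paint-properʰ = toWitness {a? = all? λ X → all? λ Y → all? λ a →
  T? (step X Y) →-dec ¬? (paint X a ≟ paint Y a)} _

paint-properᵛ : ∀ X a a' → a ≢ a' → paint X a ≢ paint X a'
paint-properᵛ = toWitness {a? = all? λ X → all? λ a → all? λ a' →
  ¬? (a ≟ a') →-dec ¬? (paint X a ≟ paint X a')} _

letterColors-lidʰ : ∀ W X Y Z a → Step W X → Step X Y → Step Y Z →
                    ¬ (letterColors W X Y a ≐∈ letterColors X Y Z a)
letterColors-lidʰ = toWitness {a? = all? λ W → all? λ X → all? λ Y → all? λ Z → all? λ a →
  T? (step W X) →-dec T? (step X Y) →-dec T? (step Y Z) →-dec
  ¬? (≐∈? (letterColors W X Y a) (letterColors X Y Z a))} _

letterColors-lidᵛ : ∀ W X Y a a' → Step W X → Step X Y → a ≢ a' →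
                    ¬ (letterColors W X Y a ≐∈ letterColors W X Y a')
letterColors-lidᵛ = toWitness {a? = all? λ W → all? λ X → all? λ Y → all? λ a → all? λ a' →
  T? (step W X) →-dec T? (step X Y) →-dec ¬? (a ≟ a') →-dec
  ¬? (≐∈? (letterColors W X Y a) (letterColors W X Y a'))} _

walkColoring : ∀ {k} → (Fin (suc k) → Fin 3) → V (Prism (suc k)) → Fin 5
walkColoring s (a , b) = paint (s b) a

module _ {k} (s : Fin (suc k) → Fin 3) (walk : ClosedWalk Step s) where

  private
    f : V (Prism (suc k)) → Fin 5
    f = walkColoring s

    into : ∀ b → Step (s (prev b)) (s b)
    into = closedWalk-into {R = Step} walk

  nbhdColors-next : ∀ a b → ¬ (nbhdColors f (a , b) ≐∈ nbhdColors f (a , next b))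
  nbhdColors-next a b = subst (λ c → ¬ (letterColors (s (prev b)) (s b) (s (next b)) a
                                        ≐∈ letterColors (s c) (s (next b)) (s (next (next b))) a))
    (sym (prev-next b))
    (letterColors-lidʰ _ _ _ _ a (into b) (walk b) (walk (next b)))

  walkColoring-proper : IsProper (Prism (suc k)) f
  walkColoring-proper (a , b) (_ , b') (inj₁ (refl , adj)) with adj⇒prev⊎next b b' adj
  ... | inj₁ refl = paint-properʰ _ _ a (into b) ∘ sym
  ... | inj₂ refl = paint-properʰ _ _ a (walk b)
  walkColoring-proper (a , b) (a' , _) (inj₂ (refl , adj)) =
    paint-properᵛ (s b) a a' (C₃-adj⇒≢ adj)

  walkColoring-lid : IsLidColoring (Prism (suc k)) f
  -- Adjacent vertices always see different colour sets, whether or not N[u] ≠ N[v].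
  walkColoring-lid = walkColoring-proper , λ u v adj _ → differ u v adj ∘ nbhdColors≐ f u v
    where
    differ : ∀ u v → Adj (Prism (suc k)) u v → ¬ (nbhdColors f u ≐∈ nbhdColors f v)
    differ (a , b) (_ , b') (inj₁ (refl , adj)) with adj⇒prev⊎next b b' adj
    ... | inj₁ refl = nbhdColors-next a (prev b) ∘ ≐-sym
                      ∘ subst (λ c → nbhdColors f (a , c) ≐∈ nbhdColors f (a , prev b)) (sym (next-prev b))
    ... | inj₂ refl = nbhdColors-next a b
    differ (a , b) (a' , _) (inj₂ (refl , adj)) =
      letterColors-lidᵛ _ _ _ a a' (into b) (walk b) (C₃-adj⇒≢ adj)

-- 0 1 0 1 … 0 1, or 0 1 0 1 … 0 1 2 for odd length.
word : ∀ m → Fin (suc (suc m)) → Fin 3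
word _             0F             = 0F
word _             1F             = 1F
word 1             2F             = 2F
word (suc (suc m)) (suc (suc i)) = word m i

word-consecutive : ∀ m (j : Fin (suc m)) → Step (word m (inject₁ j)) (word m (suc j))
word-consecutive _             0F            = tt
word-consecutive 1             1F            = tt
word-consecutive (suc (suc m)) 1F            = tt
word-consecutive (suc (suc m)) (suc (suc j)) = word-consecutive m j

word-wrap : ∀ m → Step (word m (fromℕ (suc m))) (word m zero)
word-wrap 0             = tt
word-wrap 1             = tt
word-wrap (suc (suc m)) = word-wrap m

word-closedWalk : ∀ m → ClosedWalk Step (word m)
word-closedWalk m = closedWalk-intro {R = Step} (word m) (word-consecutive m) (word-wrap m)

-- Four colors do not suffice

AtMostOneOutside : {A : Set} → List A → Set
AtMostOneOutside T = ∀ c d → c ∉ T → d ∉ T → c ≡ d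

module _ {A : Set} (_≟ᴬ_ : DecidableEquality A) (T : List A) (unique : AtMostOneOutside T) where

  open DecMembership _≟ᴬ_ using (_∈?_)

  ++-⊆-++ : {xs ys : List A} → (All (_∈ T) ys → All (_∈ T) xs) → T ++ xs ⊆ T ++ ys
  ++-⊆-++ {xs} {ys} ys⊆T⇒xs⊆T c∈ with ∈-++⁻ T c∈
  ... | inj₁ c∈T  = ∈-++⁺ˡ c∈T
  ... | inj₂ c∈xs with _ ∈? T
  ...   | yes c∈T = ∈-++⁺ˡ c∈T
  ...   | no  c∉T with All.all? (_∈? T) ys
  ...     | yes ys⊆T = ⊥-elim (c∉T (All.lookup (ys⊆T⇒xs⊆T ys⊆T) c∈xs))
  ...     | no  ys⊈T =
    let d , d∈ys , d∉T = find (¬All⇒Any¬ (_∈? T) ys ys⊈T)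
    in ∈-++⁺ʳ T (subst (_∈ ys) (sym (unique _ d c∉T d∉T)) d∈ys)

  ++-≐∈-++ : {xs ys : List A} → All (_∈ T) xs ⇔ All (_∈ T) ys → (T ++ xs) ≐∈ (T ++ ys)
  ++-≐∈-++ xs⇔ys c = mk⇔ (++-⊆-++ (from xs⇔ys)) (++-⊆-++ (to xs⇔ys))

Distinct₃ : ∀ {j} → Fin j → Fin j → Fin j → Set
Distinct₃ t₀ t₁ t₂ = t₀ ≢ t₁ × t₀ ≢ t₂ × t₁ ≢ t₂

atMostOneOutside? : ∀ j → Dec (∀ (t₀ t₁ t₂ : Fin j) → Distinct₃ t₀ t₁ t₂ → AtMostOneOutside (t₀ ∷ t₁ ∷ t₂ ∷ []))
atMostOneOutside? j = all? λ t₀ → all? λ t₁ → all? λ t₂ →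
  (¬? (t₀ ≟ t₁) ×-dec ¬? (t₀ ≟ t₂) ×-dec ¬? (t₁ ≟ t₂)) →-dec
  all? λ c → all? λ d → ¬? (c ∈? _) →-dec ¬? (d ∈? _) →-dec (c ≟ d)
  where open DecMembership _≟_ using (_∈?_)

atMostOneOutside : ∀ {j} → j < 5 → (t₀ t₁ t₂ : Fin j) → Distinct₃ t₀ t₁ t₂ →
                   AtMostOneOutside (t₀ ∷ t₁ ∷ t₂ ∷ [])
atMostOneOutside {0} _ = toWitness {a? = atMostOneOutside? 0} _
atMostOneOutside {1} _ = toWitness {a? = atMostOneOutside? 1} _
atMostOneOutside {2} _ = toWitness {a? = atMostOneOutside? 2} _
atMostOneOutside {3} _ = toWitness {a? = atMostOneOutside? 3} _
atMostOneOutside {4} _ = toWitness {a? = atMostOneOutside? 4} _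
atMostOneOutside {suc (suc (suc (suc (suc _))))} (s≤s (s≤s (s≤s (s≤s (s≤s ())))))

pigeonhole₃ : {P : Fin 3 → Set} → (∀ a → Dec (P a)) → ∃₂ λ a a' → a ≢ a' × (P a ⇔ P a')
pigeonhole₃ P? with P? 0F | P? 1F | P? 2F
... | yes p | yes q | _     = 0F , 1F , (λ ()) , mk⇔ (λ _ → q) (λ _ → p)
... | yes p | no q  | yes r = 0F , 2F , (λ ()) , mk⇔ (λ _ → r) (λ _ → p)
... | no p  | yes q | yes r = 1F , 2F , (λ ()) , mk⇔ (λ _ → r) (λ _ → q)
... | no p  | no q  | _     = 0F , 1F , (λ ()) , mk⇔ (⊥-elim ∘ p) (⊥-elim ∘ q)
... | yes p | no q  | no r  = 1F , 2F , (λ ()) , mk⇔ (⊥-elim ∘ q) (⊥-elim ∘ r)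
... | no p  | yes q | no r  = 0F , 2F , (λ ()) , mk⇔ (⊥-elim ∘ p) (⊥-elim ∘ r)

module _ {m j} (j<5 : j < 5) (f : V (Prism (suc (suc m))) → Fin j)
         (proper : IsProper (Prism (suc (suc m))) f) (b : Fin (suc (suc m))) where

  private
    open DecMembership (_≟_ {j}) using (_∈?_)

    columnColors : List (Fin j)
    columnColors = map f (column b)

    outerColors : Fin 3 → List (Fin j)
    outerColors a = f (a , prev b) ∷ f (a , next b) ∷ []

    distinct : ∀ a a' → a ≢ a' → f (a , b) ≢ f (a' , b)
    distinct a a' a≢a' = proper (a , b) (a' , b) (inj₂ (refl , C₃-adj a a' a≢a'))

    columnColors-unique : AtMostOneOutside columnColors
    columnColors-unique = atMostOneOutside j<5 _ _ _
      (distinct 0F 1F (λ ()) , distinct 0F 2F (λ ()) , distinct 1F 2F (λ ()))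

  column-nbhdColors-collide : ∃₂ λ a a' → a ≢ a' × nbhdColors f (a , b) ≐∈ nbhdColors f (a' , b)
  column-nbhdColors-collide with pigeonhole₃ (λ a → All.all? (_∈? columnColors) (outerColors a))
  ... | a , a' , a≢a' , same = a , a' , a≢a' , ++-≐∈-++ _≟_ columnColors columnColors-unique same

noLidColoring<5 : ∀ {m j} → j < 5 → (f : V (Prism (suc (suc m))) → Fin j) →
                  ¬ IsLidColoring (Prism (suc (suc m))) f
noLidColoring<5 j<5 f (proper , lid) with column-nbhdColors-collide j<5 f proper zero
... | a , a' , a≢a' , colors≐ =
  lid (a , zero) (a' , zero) (inj₂ (refl , C₃-adj a a' a≢a')) (closedNbhds-differ zero a≢a')
      (nbhdImages≐ f (a , zero) (a' , zero) colors≐)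

lemma6 : (n : ℕ) → 3 ≤ n → LidChromaticNumber (Cycle 3 □ Cycle n) 5
lemma6 (suc (suc (suc m))) (s≤s (s≤s (s≤s _))) =
  (walkColoring (word (suc m)) , walkColoring-lid (word (suc m)) (word-closedWalk (suc m)))
  , λ j j<5 f → noLidColoring<5 j<5 f
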